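{- Let $q > 5$ be a Sophie Germain prime with $z(2q+1) \mid \pi(q)$. Then the Legendre symbol $\left(\frac{5}{q}\right) = -1$ and $\pi(q) \mid 2(q+1)$.
   Context: A Sophie Germain prime is a prime $q$ with $2q+1$ prime. $F_n$ denotes the $n$-th Fibonacci number ($F_0=0$, $F_1=1$, $F_n=F_{n-1}+F_{n-2}$). For a prime $p$, $z(p)$ is the smallest positive integer $k$ with $p \mid F_k$. For a positive integer $n$, the Pisano period $\pi(n)$ is the period of $(F_m \bmod n)_{m\ge0}$. -}

module Defs where

open import Data.Nat using (ℕ; zero; suc; _+_; _*_; _<_; _≤_; _%_; NonZero)
open import Data.Nat.Divisibility using (_∣_)
open import Data.Nat.Primality using (Prime)
open import Data.Integer using (ℤ; +_; -[1+_])
open import Data.Bool using (Bool; true; false; if_then_else_)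
open import Data.Nat using (_≡ᵇ_)
open import Data.Product using (_×_; ∃)
open import Relation.Binary.PropositionalEquality using (_≡_)

fib : ℕ → ℕ
fib zero = 0
fib (suc zero) = 1
fib (suc (suc n)) = fib (suc n) + fib n

SophieGermain : ℕ → Set
SophieGermain q = Prime q × Prime (2 * q + 1)

IsRankOfApparition : ℕ → ℕ → Set
IsRankOfApparition p k =
  (0 < k) × (p ∣ fib k) × (∀ j → 0 < j → p ∣ fib j → k ≤ j)

IsFibPeriodMod : (n : ℕ) → .{{NonZero n}} → ℕ → Set
IsFibPeriodMod n k = ∀ m → fib (m + k) % n ≡ fib m % n

IsPisanoPeriod : (n : ℕ) → .{{NonZero n}} → ℕ → Set
IsPisanoPeriod n k =
  (0 < k) × IsFibPeriodMod n k × (∀ j → 0 < j → IsFibPeriodMod n j → k ≤ j)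

private
  isSquareMod : (a p : ℕ) → .{{NonZero p}} → ℕ → Bool
  isSquareMod a p zero = false
  isSquareMod a p (suc x) =
    if (x * x) % p ≡ᵇ a % p then true else isSquareMod a p x

legendre : (a p : ℕ) → .{{NonZero p}} → ℤ
legendre a p =
  if a % p ≡ᵇ 0 then + 0
  else (if isSquareMod a p p then + 1 else -[1+ 0 ])

-- For an odd prime r = 2h + 1 not dividing 5, the freshman's dream in ℕ[√5] gives
-- (1 + √5)^r ≡ 1 + 5^h √5 (mod r). As (1 + √5)^n = 2^(n-1) (Lₙ + Fₙ √5), this means
-- F(r) ≡ 5^h and 2 F(r+1) ≡ 1 + F(r), while Fermat gives 5^h ≡ ±1. If 5^h ≡ 1 then
-- F(r-1) ≡ 0 and F(r) ≡ 1, so r - 1 is a period; if 5^h ≡ -1 then F(r+1) ≡ 0 and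
-- F(r) ≡ -1, so 2(r + 1) is a period, and x² ≡ 5 would force x^(r-1) ≡ -1, so 5 is a
-- non-residue. For the Sophie Germain prime q the first case cannot happen: z(p) would
-- divide π(q) ∣ q - 1 and also p ∓ 1 = 2q or 2q + 2 (the same dichotomy for p), hence 4,
-- which is too small for p ∣ F(z(p)).
module Submission where

open import Algebra.Bundles using (CommutativeSemiring)
open import Data.Fin.Base using (Fin; zero; suc; toℕ; fromℕ; inject₁)
open import Data.Fin.Properties using (toℕ-fromℕ; inject₁ℕ<)
import Data.Nat as ℕ
open ℕ using (ℕ; zero; suc; _<_; z<s; s<s)
open import Data.Nat.Combinatorics using (_C_; nCn≡1; nC1≡n; nCk+nC[k+1]≡[n+1]C[k+1])
open import Data.Nat.Divisibility using (_∣_; divides; ∣⇒≤)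
open import Data.Nat.Primality using (Prime; euclidsLemma; ¬prime[1]; prime⇒irreducible)
import Data.Nat.Properties as ℕₚ
open import Data.Nat.Tactic.RingSolver using (solve-∀)
open import Data.Product using (∃-syntax; _,_)
open import Data.Sum using (inj₁; inj₂)
open import Data.Empty using (⊥-elim)
open import Function using (_∘_)
open import Relation.Binary.PropositionalEquality as ≡ using (_≡_)
import Relation.Binary.Reasoning.Setoid as SetoidReasoning

-- The operations of ℕ are opened only after FreshmansDream, whose semiring reuses their names.

[1+k]*[1+n]C[1+k]≡[1+n]*nCk : ∀ n k → suc k ℕ.* (suc n C suc k) ≡ suc n ℕ.* (n C k)
[1+k]*[1+n]C[1+k]≡[1+n]*nCk zero    zero    = ≡.refl
[1+k]*[1+n]C[1+k]≡[1+n]*nCk zero    (suc k) = ℕₚ.*-zeroʳ (suc (suc k))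
[1+k]*[1+n]C[1+k]≡[1+n]*nCk (suc n) zero    = ≡.trans (ℕₚ.*-identityˡ _) (≡.trans (nC1≡n (suc (suc n))) (≡.sym (ℕₚ.*-identityʳ _)))
[1+k]*[1+n]C[1+k]≡[1+n]*nCk (suc n) (suc k) = begin
  suc (suc k) * (suc (suc n) C suc (suc k))   ≡⟨ ≡.cong (suc (suc k) *_) (pascal (suc n) (suc k)) ⟨
  suc (suc k) * (c + d)                       ≡⟨ regroup₁ k c d ⟩
  (suc k * c + c) + suc (suc k) * d           ≡⟨ ≡.cong₂ (λ u v → (u + c) + v) (induct n k) (induct n (suc k)) ⟩
  (suc n * a + c) + suc n * b                 ≡⟨ ≡.cong (λ u → (suc n * a + u) + suc n * b) (pascal n k) ⟨
  (suc n * a + (a + b)) + suc n * b           ≡⟨ regroup₂ n a b ⟩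
  suc (suc n) * (a + b)                       ≡⟨ ≡.cong (suc (suc n) *_) (pascal n k) ⟩
  suc (suc n) * (suc n C suc k)               ∎
  where
  open import Data.Nat using (_+_; _*_)
  open ≡.≡-Reasoning
  induct : ∀ n k → suc k * (suc n C suc k) ≡ suc n * (n C k)
  induct = [1+k]*[1+n]C[1+k]≡[1+n]*nCk
  pascal : ∀ n k → n C k + n C suc k ≡ suc n C suc k
  pascal = nCk+nC[k+1]≡[n+1]C[k+1]
  a b c d : ℕ
  a = n C k
  b = n C suc k
  c = suc n C suc k
  d = suc n C suc (suc k)
  regroup₁ : ∀ k c d → suc (suc k) * (c + d) ≡ (suc k * c + c) + suc (suc k) * d
  regroup₁ = solve-∀
  regroup₂ : ∀ n a b → (suc n * a + (a + b)) + suc n * b ≡ suc (suc n) * (a + b)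
  regroup₂ = solve-∀

prime∣pCk : ∀ {p k} → Prime p → 0 < k → k < p → p ∣ p C k
prime∣pCk {suc n} {suc k} p-prime _ k<p
  with euclidsLemma (suc k) (suc n C suc k) p-prime
         (divides (n C k) (≡.trans ([1+k]*[1+n]C[1+k]≡[1+n]*nCk n k) (ℕₚ.*-comm (suc n) (n C k))))
... | inj₁ p∣1+k = ⊥-elim (ℕₚ.<⇒≱ k<p (∣⇒≤ p∣1+k))
... | inj₂ p∣pCk = p∣pCk

module FreshmansDream {c ℓ} (S : CommutativeSemiring c ℓ) where

  open CommutativeSemiring S hiding (zero)
  open import Algebra.Properties.Semiring.Exp semiring using (_^_)
  open import Algebra.Properties.CommutativeSemiring.Binomial S using (theorem; binomialTerm)
  open import Algebra.Properties.Monoid.Mult +-monoid using (_×_; ×-homo-1; ×-assocˡ)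
  open import Algebra.Properties.CommutativeMonoid.Mult +-commutativeMonoid using (×-distrib-+)
  open import Algebra.Properties.Monoid.Sum +-monoid using (sum; sum-init-last; sum-replicate; sum-replicate-zero)
  open SetoidReasoning setoid

  Multiple : ℕ → Carrier → Set _
  Multiple p x = ∃[ d ] x ≈ p × d

  multiple-+ : ∀ {p x y} → Multiple p x → Multiple p y → Multiple p (x + y)
  multiple-+ {p} {x} {y} (d , x≈pd) (e , y≈pe) = d + e , (begin
    x + y           ≈⟨ +-cong x≈pd y≈pe ⟩
    p × d + p × e   ≈⟨ ×-distrib-+ d e p ⟨
    p × (d + e)     ∎)

  multiple-sum : ∀ {p m} (f : Fin m → Carrier) → (∀ i → Multiple p (f i)) → Multiple p (sum f)
  multiple-sum {p} {zero}  f _        = 0# , trans (sym (sum-replicate-zero p)) (sum-replicate p)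
  multiple-sum {p} {suc m} f multiple = multiple-+ {p} (multiple zero) (multiple-sum {p} (f ∘ suc) (multiple ∘ suc))

  freshmans-dream : ∀ {p} → Prime p → ∀ x y → ∃[ d ] (x + y) ^ p ≈ x ^ p + y ^ p + p × d
  freshmans-dream {p@(suc m)} p-prime x y =
    conclude (multiple-sum {p} (term ∘ suc ∘ inject₁) middle-multiple)
    where
    term : Fin (suc p) → Carrier
    term = binomialTerm x y p

    first : term zero ≈ y ^ p
    first = trans (×-homo-1 _) (*-identityˡ _)

    middle-multiple : ∀ i → Multiple p (term (suc (inject₁ i)))
    middle-multiple i with prime∣pCk p-prime z<s (s<s (inject₁ℕ< i))
    ... | divides c pCk≡cp = c × binomial , (begin
      (p C k) × binomial      ≡⟨ ≡.cong (_× binomial) (≡.trans pCk≡cp (ℕₚ.*-comm c p)) ⟩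
      (p ℕ.* c) × binomial    ≈⟨ ×-assocˡ binomial p c ⟨
      p × c × binomial        ∎)
      where
      k : ℕ
      k = toℕ (suc (inject₁ i))
      binomial : Carrier
      binomial = x ^ k * y ^ (p ℕ.∸ k)

    top : ∀ k → k ≡ p → (p C k) × (x ^ k * y ^ (p ℕ.∸ k)) ≈ x ^ p
    top k ≡.refl rewrite nCn≡1 p | ℕₚ.n∸n≡0 p = trans (×-homo-1 _) (*-identityʳ _)

    last : term (fromℕ p) ≈ x ^ p
    last = top (toℕ (fromℕ p)) (toℕ-fromℕ p)

    conclude : Multiple p (sum (term ∘ suc ∘ inject₁)) → ∃[ d ] (x + y) ^ p ≈ x ^ p + y ^ p + p × d
    conclude (d , middle≈pd) = d , (begin
      (x + y) ^ p                                                ≈⟨ theorem p x y ⟩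
      term zero + sum (term ∘ suc)                               ≈⟨ +-congˡ (sum-init-last (term ∘ suc)) ⟩
      term zero + (sum (term ∘ suc ∘ inject₁) + term (fromℕ p))  ≈⟨ +-cong first (+-cong middle≈pd last) ⟩
      y ^ p + (p × d + x ^ p)                                    ≈⟨ +-congˡ (+-comm (p × d) (x ^ p)) ⟩
      y ^ p + (x ^ p + p × d)                                    ≈⟨ +-assoc (y ^ p) (x ^ p) (p × d) ⟨
      y ^ p + x ^ p + p × d                                      ≈⟨ +-congʳ (+-comm (y ^ p) (x ^ p)) ⟩
      x ^ p + y ^ p + p × d                                      ∎)

open import Algebra.Structures using (IsCommutativeSemiring)
open import Algebra.Structures.Biased using (IsCommutativeSemiringˡ; IsCommutativeMonoidˡ)
open import Data.Bool using (Bool; true; false; T; if_then_else_)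
open import Data.Integer using (0ℤ; 1ℤ; -[1+_])
open import Data.Nat
open import Data.Nat.DivMod hiding (_mod_)
open import Data.Nat.Divisibility
open import Data.Nat.Properties
open import Data.Product using (_×_; proj₁; proj₂)
open import Data.Sum using (_⊎_; [_,_]′; map)
open import Function using (_∋_)
open import Level using (0ℓ)
open import Relation.Nullary using (¬_)
open import Relation.Binary.Bundles using (Setoid)
open import Relation.Binary.PropositionalEquality

open import Defs

infix 4 _≡_mod_

record _≡_mod_ (a b n : ℕ) .{{_ : NonZero n}} : Set where
  constructor from-%
  field
    to-% : a % n ≡ b % n

open _≡_mod_ public

module _ {n : ℕ} .{{_ : NonZero n}} where

  ≡-mod-setoid : Setoid _ _
  ≡-mod-setoid = record
    { Carrier = ℕ
    ; _≈_ = λ a b → a ≡ b mod n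
    ; isEquivalence = record
      { refl = from-% refl
      ; sym = λ a≡b → from-% (sym (to-% a≡b))
      ; trans = λ a≡b b≡c → from-% (trans (to-% a≡b) (to-% b≡c))
      }
    }

  module ≡-mod-Reasoning = SetoidReasoning ≡-mod-setoid

  +-cong-mod : ∀ {a b c d} → a ≡ b mod n → c ≡ d mod n → a + c ≡ b + d mod n
  +-cong-mod {a} {b} {c} {d} (from-% a≡b) (from-% c≡d) = from-% (begin
    (a + c) % n             ≡⟨ %-distribˡ-+ a c n ⟩
    (a % n + c % n) % n     ≡⟨ cong₂ (λ u v → (u + v) % n) a≡b c≡d ⟩
    (b % n + d % n) % n     ≡⟨ %-distribˡ-+ b d n ⟨
    (b + d) % n             ∎)
    where open ≡-Reasoning

  *-cong-mod : ∀ {a b c d} → a ≡ b mod n → c ≡ d mod n → a * c ≡ b * d mod n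
  *-cong-mod {a} {b} {c} {d} (from-% a≡b) (from-% c≡d) = from-% (begin
    (a * c) % n             ≡⟨ %-distribˡ-* a c n ⟩
    (a % n * (c % n)) % n   ≡⟨ cong₂ (λ u v → (u * v) % n) a≡b c≡d ⟩
    (b % n * (d % n)) % n   ≡⟨ %-distribˡ-* b d n ⟨
    (b * d) % n             ∎)
    where open ≡-Reasoning

  *-congˡ-mod : ∀ a {b c} → b ≡ c mod n → a * b ≡ a * c mod n
  *-congˡ-mod a = *-cong-mod {a} {a} (from-% refl)

  *-congʳ-mod : ∀ c {a b} → a ≡ b mod n → a * c ≡ b * c mod n
  *-congʳ-mod c a≡b = *-cong-mod {c = c} {c} a≡b (from-% refl)

  +-congˡ-mod : ∀ a {b c} → b ≡ c mod n → a + b ≡ a + c mod n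
  +-congˡ-mod a = +-cong-mod {a} {a} (from-% refl)

  +-congʳ-mod : ∀ c {a b} → a ≡ b mod n → a + c ≡ b + c mod n
  +-congʳ-mod c a≡b = +-cong-mod {c = c} {c} a≡b (from-% refl)

  ^-cong-mod : ∀ {a b} k → a ≡ b mod n → a ^ k ≡ b ^ k mod n
  ^-cong-mod zero    a≡b = from-% refl
  ^-cong-mod (suc k) a≡b = *-cong-mod a≡b (^-cong-mod k a≡b)

  +-multiple-mod : ∀ a k → a + n * k ≡ a mod n
  +-multiple-mod a k = from-% (trans (cong (λ m → (a + m) % n) (*-comm n k)) ([m+kn]%n≡m%n a k n))

  -- Adding n * k - k to both sides turns the extra k into a multiple of n.
  +-cancelʳ-mod : ∀ {a b} k → a + k ≡ b + k mod n → a ≡ b mod n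
  +-cancelʳ-mod {a} {b} k a+k≡b+k = begin
    a                       ≈⟨ +-multiple-mod a k ⟨
    a + n * k               ≡⟨ absorb a ⟨
    a + k + (n * k ∸ k)     ≈⟨ +-congʳ-mod (n * k ∸ k) a+k≡b+k ⟩
    b + k + (n * k ∸ k)     ≡⟨ absorb b ⟩
    b + n * k               ≈⟨ +-multiple-mod b k ⟩
    b                       ∎
    where
    open ≡-mod-Reasoning
    absorb : ∀ c → c + k + (n * k ∸ k) ≡ c + n * k
    absorb c = trans (+-assoc c k _) (cong (c +_) (m+[n∸m]≡n (m≤n*m k n)))

  +-cancelˡ-mod : ∀ k {a b} → k + a ≡ k + b mod n → a ≡ b mod n
  +-cancelˡ-mod k {a} {b} k+a≡k+b = +-cancelʳ-mod k (begin
    a + k   ≡⟨ +-comm a k ⟩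
    k + a   ≈⟨ k+a≡k+b ⟩
    k + b   ≡⟨ +-comm k b ⟩
    b + k   ∎)
    where open ≡-mod-Reasoning

  0%n≡0 : 0 % n ≡ 0
  0%n≡0 = n∣m⇒m%n≡0 0 n (n ∣0)

  ≡0-mod⇒∣ : ∀ {a} → a ≡ 0 mod n → n ∣ a
  ≡0-mod⇒∣ {a} (from-% a≡0) = m%n≡0⇒n∣m a n (trans a≡0 0%n≡0)

  ∣⇒≡0-mod : ∀ {a} → n ∣ a → a ≡ 0 mod n
  ∣⇒≡0-mod {a} n∣a = from-% (trans (n∣m⇒m%n≡0 a n n∣a) (sym 0%n≡0))

  x+1≡0⇒x*x≡1 : ∀ {x} → x + 1 ≡ 0 mod n → x * x ≡ 1 mod n
  x+1≡0⇒x*x≡1 {x} x+1≡0 = +-cancelʳ-mod (x + 1) (begin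
    x * x + (x + 1)   ≡⟨ x*x+[x+1]≡x*[x+1]+1 x ⟩
    x * (x + 1) + 1   ≈⟨ +-congʳ-mod 1 (*-congˡ-mod x x+1≡0) ⟩
    x * 0 + 1         ≡⟨ cong (_+ 1) (*-zeroʳ x) ⟩
    1 + 0             ≈⟨ +-congˡ-mod 1 x+1≡0 ⟨
    1 + (x + 1)       ∎)
    where
    open ≡-mod-Reasoning
    x*x+[x+1]≡x*[x+1]+1 : ∀ x → x * x + (x + 1) ≡ x * (x + 1) + 1
    x*x+[x+1]≡x*[x+1]+1 = solve-∀

  a*x²≡a⇒x≡±1 : ∀ {a} → Prime n → ¬ n ∣ a → ∀ x → a * (x * x) ≡ a mod n →
                x ≡ 1 mod n ⊎ x + 1 ≡ 0 mod n
  a*x²≡a⇒x≡±1 {a} _ n∤a zero a*0≡a = ⊥-elim (n∤a (≡0-mod⇒∣ (begin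
    a               ≈⟨ a*0≡a ⟨
    a * 0           ≡⟨ *-zeroʳ a ⟩
    0               ∎)))
    where open ≡-mod-Reasoning
  a*x²≡a⇒x≡±1 {a} n-prime n∤a (suc y) a*x²≡a
    with euclidsLemma a (y * (y + 2)) n-prime (≡0-mod⇒∣ (+-cancelˡ-mod a (begin
      a + a * (y * (y + 2))   ≡⟨ a+a*[y*[y+2]]≡a*[[1+y]*[1+y]] a y ⟩
      a * (suc y * suc y)     ≈⟨ a*x²≡a ⟩
      a                       ≡⟨ +-identityʳ a ⟨
      a + 0                   ∎)))
    where
    open ≡-mod-Reasoning
    a+a*[y*[y+2]]≡a*[[1+y]*[1+y]] : ∀ a y → a + a * (y * (y + 2)) ≡ a * (suc y * suc y)
    a+a*[y*[y+2]]≡a*[[1+y]*[1+y]] = solve-∀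
  ... | inj₁ n∣a = ⊥-elim (n∤a n∣a)
  ... | inj₂ n∣y[y+2] with euclidsLemma y (y + 2) n-prime n∣y[y+2]
  ...   | inj₁ n∣y = inj₁ (+-congˡ-mod 1 (∣⇒≡0-mod n∣y))
  ...   | inj₂ n∣y+2 = inj₂ (∣⇒≡0-mod (subst (n ∣_) (+-suc y 1) n∣y+2))

-- h + 1 is the inverse of 2 modulo 2h + 1.
*2-cancel-mod : ∀ h {a b} → 2 * a ≡ 2 * b mod suc (2 * h) → a ≡ b mod suc (2 * h)
*2-cancel-mod h {a} {b} 2a≡2b = begin
  a                  ≈⟨ +-multiple-mod a a ⟨
  a + r * a          ≡⟨ [h+1]*[2*c]≡c+[1+2h]*c h a ⟨
  suc h * (2 * a)    ≈⟨ *-congˡ-mod (suc h) 2a≡2b ⟩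
  suc h * (2 * b)    ≡⟨ [h+1]*[2*c]≡c+[1+2h]*c h b ⟩
  b + r * b          ≈⟨ +-multiple-mod b b ⟩
  b                  ∎
  where
  open ≡-mod-Reasoning
  r : ℕ
  r = suc (2 * h)
  [h+1]*[2*c]≡c+[1+2h]*c : ∀ h c → suc h * (2 * c) ≡ c + suc (2 * h) * c
  [h+1]*[2*c]≡c+[1+2h]*c = solve-∀

fib-suc-+ : ∀ m n → fib (suc (m + n)) ≡ fib (suc m) * fib (suc n) + fib m * fib n
fib-suc-+ zero    n = sym (trans (+-identityʳ _) (*-identityˡ _))
fib-suc-+ (suc m) n = begin
  fib (suc (suc m + n))                                    ≡⟨ cong (fib ∘ suc) (+-suc m n) ⟨
  fib (suc (m + suc n))                                    ≡⟨ fib-suc-+ m (suc n) ⟩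
  fib (suc m) * (fib (suc n) + fib n) + fib m * fib (suc n) ≡⟨ regroup (fib (suc m)) (fib m) (fib (suc n)) (fib n) ⟩
  (fib (suc m) + fib m) * fib (suc n) + fib (suc m) * fib n ∎
  where
  open ≡-Reasoning
  regroup : ∀ x y u v → x * (u + v) + y * u ≡ (x + y) * u + x * v
  regroup = solve-∀

fib-coprime : ∀ {d} n → d ∣ fib n → d ∣ fib (suc n) → d ∣ 1
fib-coprime zero    _      d∣1    = d∣1
fib-coprime (suc n) d∣Fn+1 d∣Fn+2 = fib-coprime n (∣m+n∣m⇒∣n d∣Fn+2 d∣Fn+1) d∣Fn+1

-- Subtracting k repeatedly reduces m to m % k, which the minimality of k forces to be 0.
least-positive⇒∣ : ∀ (P : ℕ → Set) {k} → 0 < k → (∀ j → 0 < j → P j → k ≤ j) →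
                   (∀ j → P (k + j) → P j) → ∀ {m} → P m → k ∣ m
least-positive⇒∣ P {k} 0<k least descend {m} Pm =
  m%n≡0⇒n∣m m k (below-least (m % k) (m%n<n m k) (descend* (m / k) (m % k) (subst P (m≡m%n+[m/n]*n m k) Pm)))
  where
  instance _ = >-nonZero 0<k
  descend* : ∀ t j → P (j + t * k) → P j
  descend* zero    j = subst P (+-identityʳ j)
  descend* (suc t) j P[j+k+tk] = descend* t j (descend (j + t * k) (subst P (x+[y+z]≡y+[x+z] j k (t * k)) P[j+k+tk]))
    where
    x+[y+z]≡y+[x+z] : ∀ x y z → x + (y + z) ≡ y + (x + z)
    x+[y+z]≡y+[x+z] = solve-∀
  below-least : ∀ j → j < k → P j → j ≡ 0
  below-least zero    _   _  = refl
  below-least (suc j) j<k Pj = ⊥-elim (<⇒≱ j<k (least (suc j) z<s Pj))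

rank∣ : ∀ {p z m} → Prime p → IsRankOfApparition p z → p ∣ fib m → z ∣ m
rank∣ {p} {suc z} p-prime (0<z , p∣Fz , least) = least-positive⇒∣ (λ j → p ∣ fib j) 0<z least descend
  where
  descend : ∀ j → p ∣ fib (suc z + j) → p ∣ fib j
  descend j p∣Fz+j with euclidsLemma (fib z) (fib j) p-prime
    (∣m+n∣m⇒∣n (subst (p ∣_) (fib-suc-+ z j) p∣Fz+j) (∣m⇒∣m*n (fib (suc j)) p∣Fz))
  ... | inj₁ p∣Fz-1 = ⊥-elim (¬prime[1] (subst Prime (∣1⇒≡1 (fib-coprime z p∣Fz-1 p∣Fz)) p-prime))
  ... | inj₂ p∣Fj   = p∣Fj

pisano∣ : ∀ {n} .{{_ : NonZero n}} {π k} → IsPisanoPeriod n π → IsFibPeriodMod n k → π ∣ k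
pisano∣ {n} {π} (0<π , period , least) = least-positive⇒∣ (IsFibPeriodMod n) 0<π least descend
  where
  descend : ∀ j → IsFibPeriodMod n (π + j) → IsFibPeriodMod n j
  descend j period[π+j] m = begin
    fib (m + j) % n         ≡⟨ period (m + j) ⟨
    fib (m + j + π) % n     ≡⟨ cong (λ i → fib i % n) (trans (+-assoc m j π) (cong (m +_) (+-comm j π))) ⟩
    fib (m + (π + j)) % n   ≡⟨ period[π+j] m ⟩
    fib m % n               ∎
    where open ≡-Reasoning

fib-shift : ∀ {n} .{{_ : NonZero n}} {k c} → fib k ≡ 0 mod n → fib (suc k) ≡ c mod n →
            ∀ m → fib (m + k) ≡ c * fib m mod n
fib-shift {k = k} {c} Fk≡0 _ zero = begin
  fib k     ≈⟨ Fk≡0 ⟩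
  0         ≡⟨ *-zeroʳ c ⟨
  c * 0     ∎
  where open ≡-mod-Reasoning
fib-shift {k = k} {c} Fk≡0 Fk+1≡c (suc m) = begin
  fib (suc (m + k))                           ≡⟨ fib-suc-+ m k ⟩
  fib (suc m) * fib (suc k) + fib m * fib k   ≈⟨ +-cong-mod (*-congˡ-mod (fib (suc m)) Fk+1≡c) (*-congˡ-mod (fib m) Fk≡0) ⟩
  fib (suc m) * c + fib m * 0                 ≡⟨ x*c+y*0≡c*x (fib (suc m)) (fib m) c ⟩
  c * fib (suc m)                             ∎
  where
  open ≡-mod-Reasoning
  x*c+y*0≡c*x : ∀ x y c → x * c + y * 0 ≡ c * x
  x*c+y*0≡c*x = solve-∀

fib-period : ∀ {n} .{{_ : NonZero n}} {k} → fib k ≡ 0 mod n → fib (suc k) ≡ 1 mod n → IsFibPeriodMod n k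
fib-period Fk≡0 Fk+1≡1 m = to-% (begin
  fib (m + _)   ≈⟨ fib-shift Fk≡0 Fk+1≡1 m ⟩
  1 * fib m     ≡⟨ *-identityˡ (fib m) ⟩
  fib m         ∎)
  where open ≡-mod-Reasoning

infix  5 _+√5_
infixl 6 _⊕_
infixl 7 _⊗_

record ℕ[√5] : Set where
  constructor _+√5_
  field
    ℕ-part √5-part : ℕ

open ℕ[√5]

_⊕_ : ℕ[√5] → ℕ[√5] → ℕ[√5]
(a +√5 b) ⊕ (c +√5 d) = a + c +√5 b + d

_⊗_ : ℕ[√5] → ℕ[√5] → ℕ[√5]
(a +√5 b) ⊗ (c +√5 d) = a * c + 5 * (b * d) +√5 a * d + b * c

ℕ[√5]-isCommutativeSemiring : IsCommutativeSemiring _≡_ _⊕_ _⊗_ (0 +√5 0) (1 +√5 0)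
ℕ[√5]-isCommutativeSemiring = IsCommutativeSemiringˡ.isCommutativeSemiring (record
  { +-isCommutativeMonoid = IsCommutativeMonoidˡ.isCommutativeMonoid (record
    { isSemigroup = record { isMagma = record { isEquivalence = isEquivalence ; ∙-cong = cong₂ _⊕_ } ; assoc = ⊕-assoc }
    ; identityˡ   = λ _ → refl
    ; comm        = ⊕-comm
    })
  ; *-isCommutativeMonoid = IsCommutativeMonoidˡ.isCommutativeMonoid (record
    { isSemigroup = record { isMagma = record { isEquivalence = isEquivalence ; ∙-cong = cong₂ _⊗_ } ; assoc = ⊗-assoc }
    ; identityˡ   = ⊗-identityˡ
    ; comm        = ⊗-comm
    })
  ; distribʳ = ⊗-distribʳ-⊕
  ; zeroˡ    = λ _ → refl
  })
  where
  ⊕-assoc : ∀ x y z → x ⊕ y ⊕ z ≡ x ⊕ (y ⊕ z)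
  ⊕-assoc (a +√5 b) (c +√5 d) (e +√5 f) = cong₂ _+√5_ (+-assoc a c e) (+-assoc b d f)
  ⊕-comm : ∀ x y → x ⊕ y ≡ y ⊕ x
  ⊕-comm (a +√5 b) (c +√5 d) = cong₂ _+√5_ (+-comm a c) (+-comm b d)
  ⊗-assoc : ∀ x y z → x ⊗ y ⊗ z ≡ x ⊗ (y ⊗ z)
  ⊗-assoc (a +√5 b) (c +√5 d) (e +√5 f) = cong₂ _+√5_ (ℕ-part-assoc a b c d e f) (√5-part-assoc a b c d e f)
    where
    ℕ-part-assoc : ∀ a b c d e f → (a * c + 5 * (b * d)) * e + 5 * ((a * d + b * c) * f) ≡ a * (c * e + 5 * (d * f)) + 5 * (b * (c * f + d * e))
    ℕ-part-assoc = solve-∀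
    √5-part-assoc : ∀ a b c d e f → (a * c + 5 * (b * d)) * f + (a * d + b * c) * e ≡ a * (c * f + d * e) + b * (c * e + 5 * (d * f))
    √5-part-assoc = solve-∀
  ⊗-comm : ∀ x y → x ⊗ y ≡ y ⊗ x
  ⊗-comm (a +√5 b) (c +√5 d) = cong₂ _+√5_ (cong₂ _+_ (*-comm a c) (cong (5 *_) (*-comm b d))) (trans (+-comm (a * d) (b * c)) (cong₂ _+_ (*-comm b c) (*-comm a d)))
  ⊗-identityˡ : ∀ x → (1 +√5 0) ⊗ x ≡ x
  ⊗-identityˡ (a +√5 b) = cong₂ _+√5_ (trans (+-identityʳ _) (+-identityʳ a)) (trans (+-identityʳ _) (+-identityʳ b))
  ⊗-distribʳ-⊕ : ∀ x y z → (y ⊕ z) ⊗ x ≡ y ⊗ x ⊕ z ⊗ x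
  ⊗-distribʳ-⊕ (e +√5 f) (a +√5 b) (c +√5 d) = cong₂ _+√5_ (ℕ-part-distrib a b c d e f) (√5-part-distrib a b c d e f)
    where
    ℕ-part-distrib : ∀ a b c d e f → (a + c) * e + 5 * ((b + d) * f) ≡ a * e + 5 * (b * f) + (c * e + 5 * (d * f))
    ℕ-part-distrib = solve-∀
    √5-part-distrib : ∀ a b c d e f → (a + c) * f + (b + d) * e ≡ a * f + b * e + (c * f + d * e)
    √5-part-distrib = solve-∀

ℕ[√5]-commutativeSemiring : CommutativeSemiring 0ℓ 0ℓ
ℕ[√5]-commutativeSemiring = record { isCommutativeSemiring = ℕ[√5]-isCommutativeSemiring }

open import Algebra.Properties.Semiring.Exp (CommutativeSemiring.semiring ℕ[√5]-commutativeSemiring) using () renaming (_^_ to _⊗^_)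
open import Algebra.Properties.Monoid.Mult (CommutativeSemiring.+-monoid ℕ[√5]-commutativeSemiring) using () renaming (_×_ to _·_)

·-+√5 : ∀ n a b → n · (a +√5 b) ≡ n * a +√5 n * b
·-+√5 zero    a b = refl
·-+√5 (suc n) a b = cong ((a +√5 b) ⊕_) (·-+√5 n a b)

ω : ℕ[√5]
ω = 1 +√5 1

-- ω^n = 2^(n-1) (Lₙ + Fₙ√5); the Lucas number is eliminated through Lₙ + Fₙ = 2Fₙ₊₁.
ω^n-fib : ∀ n → 2 * √5-part (ω ⊗^ n) ≡ 2 ^ n * fib n
              × 2 * ℕ-part (ω ⊗^ n) + 2 ^ n * fib n ≡ 2 ^ suc n * fib (suc n)
ω^n-fib zero    = refl , refl
ω^n-fib (suc n) = √5-step , +-cancelʳ-≡ (2 ^ n * fib n) _ _ ℕ-step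
  where
  A B p : ℕ
  A = ℕ-part (ω ⊗^ n)
  B = √5-part (ω ⊗^ n)
  p = 2 ^ n
  IH : 2 * B ≡ p * fib n × 2 * A + p * fib n ≡ 2 * p * fib (suc n)
  IH = ω^n-fib n
  √5-step : 2 * (1 * B + 1 * A) ≡ 2 * p * fib (suc n)
  √5-step = begin
    2 * (1 * B + 1 * A)   ≡⟨ regroup A B ⟩
    2 * B + 2 * A         ≡⟨ cong (_+ 2 * A) (proj₁ IH) ⟩
    p * fib n + 2 * A     ≡⟨ +-comm (p * fib n) (2 * A) ⟩
    2 * A + p * fib n     ≡⟨ proj₂ IH ⟩
    2 * p * fib (suc n)   ∎
    where
    open ≡-Reasoning
    regroup : ∀ A B → 2 * (1 * B + 1 * A) ≡ 2 * B + 2 * A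
    regroup = solve-∀
  ℕ-step : 2 * (1 * A + 5 * (1 * B)) + 2 * p * fib (suc n) + p * fib n
           ≡ 2 * (2 * p) * (fib (suc n) + fib n) + p * fib n
  ℕ-step = begin
    2 * (1 * A + 5 * (1 * B)) + 2 * p * fib (suc n) + p * fib n
      ≡⟨ regroup₁ A B p (fib n) (fib (suc n)) ⟩
    (2 * A + p * fib n) + 5 * (2 * B) + 2 * p * fib (suc n)
      ≡⟨ cong₂ (λ u v → u + 5 * v + 2 * p * fib (suc n)) (proj₂ IH) (proj₁ IH) ⟩
    2 * p * fib (suc n) + 5 * (p * fib n) + 2 * p * fib (suc n)
      ≡⟨ regroup₂ p (fib n) (fib (suc n)) ⟩
    2 * (2 * p) * (fib (suc n) + fib n) + p * fib n
      ∎
    where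
    open ≡-Reasoning
    regroup₁ : ∀ A B p f₀ f₁ → 2 * (1 * A + 5 * (1 * B)) + 2 * p * f₁ + p * f₀
                              ≡ (2 * A + p * f₀) + 5 * (2 * B) + 2 * p * f₁
    regroup₁ = solve-∀
    regroup₂ : ∀ p f₀ f₁ → 2 * p * f₁ + 5 * (p * f₀) + 2 * p * f₁ ≡ 2 * (2 * p) * (f₁ + f₀) + p * f₀
    regroup₂ = solve-∀

open FreshmansDream ℕ[√5]-commutativeSemiring using (freshmans-dream)

ℕ-^-homo : ∀ a n → (a +√5 0) ⊗^ n ≡ a ^ n +√5 0
ℕ-^-homo a zero    = refl
ℕ-^-homo a (suc n) = trans (cong ((a +√5 0) ⊗_) (ℕ-^-homo a n)) (cong₂ _+√5_ (+-identityʳ _) (trans (+-identityʳ _) (*-zeroʳ a)))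

√5 : ℕ[√5]
√5 = 0 +√5 1

√5-^-odd : ∀ h → √5 ⊗^ suc (2 * h) ≡ 0 +√5 5 ^ h
√5-^-odd zero    = refl
√5-^-odd (suc h) = begin
  √5 ⊗^ suc (2 * suc h)              ≡⟨ cong (λ k → √5 ⊗^ suc k) (*-suc 2 h) ⟩
  √5 ⊗ (√5 ⊗ (√5 ⊗^ suc (2 * h)))    ≡⟨ cong (λ x → √5 ⊗ (√5 ⊗ x)) (√5-^-odd h) ⟩
  √5 ⊗ (√5 ⊗ (0 +√5 5 ^ h))          ≡⟨ cong (0 +√5_) (normalise (5 ^ h)) ⟩
  0 +√5 5 ^ suc h                    ∎
  where
  open ≡-Reasoning
  normalise : ∀ c → 0 * (0 * c + 1 * 0) + 1 * (0 * 0 + 5 * (1 * c)) ≡ 5 * c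
  normalise = solve-∀

fermat : ∀ {p} .{{_ : NonZero p}} → Prime p → ∀ a → a ^ p ≡ a mod p
fermat {suc _} _       zero    = from-% refl
fermat {p}     p-prime (suc a) with freshmans-dream p-prime (1 +√5 0) (a +√5 0)
... | D , dream = begin
  suc a ^ p                                                       ≡⟨ cong ℕ-part (ℕ-^-homo (suc a) p) ⟨
  ℕ-part ((suc a +√5 0) ⊗^ p)                                     ≡⟨ cong ℕ-part dream ⟩
  ℕ-part ((1 +√5 0) ⊗^ p) + ℕ-part ((a +√5 0) ⊗^ p) + ℕ-part (p · D)
    ≡⟨ cong₂ _+_ (cong₂ _+_ (cong ℕ-part (ℕ-^-homo 1 p)) (cong ℕ-part (ℕ-^-homo a p))) (cong ℕ-part (·-+√5 p _ _)) ⟩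
  1 ^ p + a ^ p + p * ℕ-part D                                    ≈⟨ +-multiple-mod (1 ^ p + a ^ p) (ℕ-part D) ⟩
  1 ^ p + a ^ p                                                   ≡⟨ cong (_+ a ^ p) (^-zeroˡ p) ⟩
  1 + a ^ p                                                       ≈⟨ +-congˡ-mod 1 (fermat p-prime a) ⟩
  suc a                                                           ∎
  where open ≡-mod-Reasoning

-- The search behind `legendre` is private to Defs. It is named here as a metavariable that
-- unification solves: with-abstracting the modulus of the unfolded `legendre a (suc x)` leaves
-- the pattern problem `isSquareMod a m x = Defs.isSquareMod a m x`.
private mutual
  isSquareMod : (a p : ℕ) → .{{NonZero p}} → ℕ → Bool
  isSquareMod = _

  legendre-suc : ∀ a x → legendre a (suc x) ≡
                 (if a % suc x ≡ᵇ 0 then 0ℤ else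
                   (if (if (x * x) % suc x ≡ᵇ a % suc x then true else isSquareMod a (suc x) x) then 1ℤ else -[1+ 0 ]))
  legendre-suc a x with suc x | (NonZero (suc x) ∋ _)
  ... | _ | _ = refl

isSquareMod-false : ∀ {a p} .{{_ : NonZero p}} → (∀ y → ¬ y * y ≡ a mod p) → ∀ x → isSquareMod a p x ≡ false
isSquareMod-false non-square zero = refl
isSquareMod-false {a} {p} non-square (suc x) with (x * x) % p ≡ᵇ a % p in x²≡ᵇa
... | true  = ⊥-elim (non-square x (from-% (≡ᵇ⇒≡ _ _ (subst T (sym x²≡ᵇa) _))))
... | false = isSquareMod-false non-square x

legendre-non-residue : ∀ a x → ¬ suc x ∣ a → (∀ y → ¬ y * y ≡ a mod suc x) → legendre a (suc x) ≡ -[1+ 0 ]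
legendre-non-residue a x p∤a non-square =
  trans (legendre-suc a x) (both-false a%p≢0 (isSquareMod-false non-square (suc x)))
  where
  both-false : ∀ {b c} → b ≡ false → c ≡ false → (if b then 0ℤ else (if c then 1ℤ else -[1+ 0 ])) ≡ -[1+ 0 ]
  both-false refl refl = refl
  a%p≢0 : (a % suc x ≡ᵇ 0) ≡ false
  a%p≢0 with a % suc x ≡ᵇ 0 in a%p≡ᵇ0
  ... | true  = ⊥-elim (p∤a (m%n≡0⇒n∣m a (suc x) (≡ᵇ⇒≡ _ 0 (subst T (sym a%p≡ᵇ0) _))))
  ... | false = refl

x^[2*h]≡[x*x]^h : ∀ x h → x ^ (2 * h) ≡ (x * x) ^ h
x^[2*h]≡[x*x]^h x h = trans (sym (^-*-assoc x 2 h)) (cong (λ y → (x * y) ^ h) (*-identityʳ x))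

module FibonacciModPrime (h : ℕ) (r-prime : Prime (suc (2 * h))) (r∤5 : ¬ suc (2 * h) ∣ 5) where

  r : ℕ
  r = suc (2 * h)

  ω^r-expansion : ∃[ d₁ ] ∃[ d₂ ] ω ⊗^ r ≡ 1 + r * d₁ +√5 5 ^ h + r * d₂
  ω^r-expansion = expand (freshmans-dream r-prime (1 +√5 0) √5)
    where
    expand : ∃[ D ] ω ⊗^ r ≡ (1 +√5 0) ⊗^ r ⊕ √5 ⊗^ r ⊕ r · D →
             ∃[ d₁ ] ∃[ d₂ ] ω ⊗^ r ≡ 1 + r * d₁ +√5 5 ^ h + r * d₂
    expand (d₁ +√5 d₂ , dream) = d₁ , d₂ , (begin
      ω ⊗^ r                                            ≡⟨ dream ⟩
      (1 +√5 0) ⊗^ r ⊕ √5 ⊗^ r ⊕ r · (d₁ +√5 d₂)        ≡⟨ cong₂ (λ x y → x ⊕ y ⊕ r · (d₁ +√5 d₂)) (ℕ-^-homo 1 r) (√5-^-odd h) ⟩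
      (1 ^ r +√5 0) ⊕ (0 +√5 5 ^ h) ⊕ r · (d₁ +√5 d₂)  ≡⟨ cong ((1 ^ r +√5 0) ⊕ (0 +√5 5 ^ h) ⊕_) (·-+√5 r d₁ d₂) ⟩
      1 ^ r + 0 + r * d₁ +√5 5 ^ h + r * d₂             ≡⟨ cong (λ x → x + r * d₁ +√5 5 ^ h + r * d₂) (trans (+-identityʳ _) (^-zeroˡ r)) ⟩
      1 + r * d₁ +√5 5 ^ h + r * d₂                     ∎)
      where open ≡-Reasoning

  ω^r≡1+5^h√5 : ℕ-part (ω ⊗^ r) ≡ 1 mod r × √5-part (ω ⊗^ r) ≡ 5 ^ h mod r
  ω^r≡1+5^h√5 = components ω^r-expansion
    where
    open ≡-mod-Reasoning
    components : ∃[ d₁ ] ∃[ d₂ ] ω ⊗^ r ≡ 1 + r * d₁ +√5 5 ^ h + r * d₂ →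
                 ℕ-part (ω ⊗^ r) ≡ 1 mod r × √5-part (ω ⊗^ r) ≡ 5 ^ h mod r
    components (d₁ , d₂ , expansion) = (begin
      ℕ-part (ω ⊗^ r)    ≡⟨ cong ℕ-part expansion ⟩
      1 + r * d₁         ≈⟨ +-multiple-mod 1 d₁ ⟩
      1                  ∎) , (begin
      √5-part (ω ⊗^ r)   ≡⟨ cong √5-part expansion ⟩
      5 ^ h + r * d₂     ≈⟨ +-multiple-mod (5 ^ h) d₂ ⟩
      5 ^ h              ∎)

  fermat-r : ∀ a → a ^ r ≡ a mod r
  fermat-r = fermat r-prime

  fib[r]≡5^h : fib r ≡ 5 ^ h mod r
  fib[r]≡5^h = *2-cancel-mod h (begin
    2 * fib r                ≈⟨ *-congʳ-mod (fib r) (fermat-r 2) ⟨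
    2 ^ r * fib r            ≡⟨ proj₁ (ω^n-fib r) ⟨
    2 * √5-part (ω ⊗^ r)     ≈⟨ *-congˡ-mod 2 (proj₂ ω^r≡1+5^h√5) ⟩
    2 * 5 ^ h                ∎)
    where open ≡-mod-Reasoning

  2*fib[1+r]≡1+fib[r] : 2 * fib (suc r) ≡ 1 + fib r mod r
  2*fib[1+r]≡1+fib[r] = *2-cancel-mod h (begin
    2 * (2 * fib (suc r))                  ≡⟨ *-assoc 2 2 (fib (suc r)) ⟨
    2 * 2 * fib (suc r)                    ≈⟨ *-congʳ-mod (fib (suc r)) (*-congˡ-mod 2 (fermat-r 2)) ⟨
    2 * 2 ^ r * fib (suc r)                ≡⟨ proj₂ (ω^n-fib r) ⟨
    2 * ℕ-part (ω ⊗^ r) + 2 ^ r * fib r    ≈⟨ +-cong-mod (*-congˡ-mod 2 (proj₁ ω^r≡1+5^h√5)) (*-congʳ-mod (fib r) (fermat-r 2)) ⟩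
    2 * 1 + 2 * fib r                      ≡⟨ *-distribˡ-+ 2 1 (fib r) ⟨
    2 * (1 + fib r)                        ∎)
    where open ≡-mod-Reasoning

  5^h≡±1 : 5 ^ h ≡ 1 mod r ⊎ 5 ^ h + 1 ≡ 0 mod r
  5^h≡±1 = a*x²≡a⇒x≡±1 r-prime r∤5 (5 ^ h) (begin
    5 * (5 ^ h * 5 ^ h)   ≡⟨ cong (5 *_) (^-distribˡ-+-* 5 h h) ⟨
    5 * 5 ^ (h + h)       ≡⟨ cong (λ k → 5 * 5 ^ (h + k)) (+-identityʳ h) ⟨
    5 ^ r                 ≈⟨ fermat-r 5 ⟩
    5                     ∎)
    where open ≡-mod-Reasoning

  residue-period : 5 ^ h ≡ 1 mod r → IsFibPeriodMod r (2 * h)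
  residue-period 5^h≡1 = fib-period fib[2h]≡0 fib[r]≡1
    where
    open ≡-mod-Reasoning
    fib[r]≡1 : fib r ≡ 1 mod r
    fib[r]≡1 = begin
      fib r    ≈⟨ fib[r]≡5^h ⟩
      5 ^ h    ≈⟨ 5^h≡1 ⟩
      1        ∎
    fib[1+r]≡1 : fib (suc r) ≡ 1 mod r
    fib[1+r]≡1 = *2-cancel-mod h (begin
      2 * fib (suc r)   ≈⟨ 2*fib[1+r]≡1+fib[r] ⟩
      1 + fib r         ≈⟨ +-congˡ-mod 1 fib[r]≡1 ⟩
      2 * 1             ∎)
    fib[2h]≡0 : fib (2 * h) ≡ 0 mod r
    fib[2h]≡0 = +-cancelˡ-mod (fib r) (begin
      fib r + fib (2 * h)   ≈⟨ fib[1+r]≡1 ⟩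
      1                     ≈⟨ fib[r]≡1 ⟨
      fib r                 ≡⟨ +-identityʳ (fib r) ⟨
      fib r + 0             ∎)

  module NonResidue (5^h+1≡0 : 5 ^ h + 1 ≡ 0 mod r) where

    fib[r]+1≡0 : fib r + 1 ≡ 0 mod r
    fib[r]+1≡0 = begin
      fib r + 1    ≈⟨ +-congʳ-mod 1 fib[r]≡5^h ⟩
      5 ^ h + 1    ≈⟨ 5^h+1≡0 ⟩
      0            ∎
      where open ≡-mod-Reasoning

    fib[1+r]≡0 : fib (suc r) ≡ 0 mod r
    fib[1+r]≡0 = *2-cancel-mod h (begin
      2 * fib (suc r)   ≈⟨ 2*fib[1+r]≡1+fib[r] ⟩
      1 + fib r         ≡⟨ +-comm 1 (fib r) ⟩
      fib r + 1         ≈⟨ fib[r]+1≡0 ⟩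
      2 * 0             ∎)
      where open ≡-mod-Reasoning

    -- Shifting by r + 1 multiplies by F(r+2) ≡ F(r) ≡ -1, so shifting twice is the identity.
    period : IsFibPeriodMod r (2 * (r + 1))
    period m = to-% (begin
      fib (m + 2 * (r + 1))      ≡⟨ cong fib (m+2*[r+1]≡m+[1+r]+[1+r] m r) ⟩
      fib (m + suc r + suc r)    ≈⟨ shift (m + suc r) ⟩
      c * fib (m + suc r)        ≈⟨ *-congˡ-mod c (shift m) ⟩
      c * (c * fib m)            ≡⟨ *-assoc c c (fib m) ⟨
      c * c * fib m              ≈⟨ *-congʳ-mod (fib m) (x+1≡0⇒x*x≡1 c+1≡0) ⟩
      1 * fib m                  ≡⟨ *-identityˡ (fib m) ⟩
      fib m                      ∎)
      where
      open ≡-mod-Reasoning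
      c : ℕ
      c = fib (suc (suc r))
      shift : ∀ m → fib (m + suc r) ≡ c * fib m mod r
      shift = fib-shift {c = c} fib[1+r]≡0 (from-% refl)
      c+1≡0 : c + 1 ≡ 0 mod r
      c+1≡0 = begin
        fib (suc r) + fib r + 1   ≈⟨ +-congʳ-mod 1 (+-congʳ-mod (fib r) fib[1+r]≡0) ⟩
        fib r + 1                 ≈⟨ fib[r]+1≡0 ⟩
        0                         ∎
      m+2*[r+1]≡m+[1+r]+[1+r] : ∀ m r → m + 2 * (r + 1) ≡ m + suc r + suc r
      m+2*[r+1]≡m+[1+r]+[1+r] = solve-∀

    5-non-square : ∀ x → ¬ x * x ≡ 5 mod r
    5-non-square x x²≡5 = r∤5 (≡0-mod⇒∣ (begin
      5        ≈⟨ x²≡5 ⟨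
      x * x    ≈⟨ *-cong-mod x≡0 x≡0 ⟩
      0        ∎))
      where
      open ≡-mod-Reasoning
      x*5^h≡x : x * 5 ^ h ≡ x mod r
      x*5^h≡x = begin
        x * 5 ^ h          ≈⟨ *-congˡ-mod x (^-cong-mod h x²≡5) ⟨
        x * (x * x) ^ h    ≡⟨ cong (x *_) (x^[2*h]≡[x*x]^h x h) ⟨
        x ^ r              ≈⟨ fermat-r x ⟩
        x                  ∎
      x≡0 : x ≡ 0 mod r
      x≡0 = *2-cancel-mod h (begin
        2 * x              ≡⟨ 2*x≡x+x x ⟩
        x + x              ≈⟨ +-congʳ-mod x x*5^h≡x ⟨
        x * 5 ^ h + x      ≡⟨ x*y+x≡x*[y+1] x (5 ^ h) ⟩
        x * (5 ^ h + 1)    ≈⟨ *-congˡ-mod x 5^h+1≡0 ⟩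
        x * 0              ≡⟨ *-zeroʳ x ⟩
        2 * 0              ∎)
        where
        2*x≡x+x : ∀ x → 2 * x ≡ x + x
        2*x≡x+x = solve-∀
        x*y+x≡x*[y+1] : ∀ x y → x * y + x ≡ x * (y + 1)
        x*y+x≡x*[y+1] = solve-∀

    legendre[5/r]≡-1 : legendre 5 r ≡ -[1+ 0 ]
    legendre[5/r]≡-1 = legendre-non-residue 5 (2 * h) r∤5 5-non-square

  r∣fib[r∓1] : r ∣ fib (2 * h) ⊎ r ∣ fib (suc r)
  r∣fib[r∓1] = [ (λ 5^h≡1 → inj₁ (≡0-mod⇒∣ (from-% (residue-period 5^h≡1 0))))
               , (λ 5^h+1≡0 → inj₂ (≡0-mod⇒∣ (NonResidue.fib[1+r]≡0 5^h+1≡0)))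
               ]′ 5^h≡±1

odd-prime : ∀ {p} → Prime p → 2 < p → ∃[ h ] p ≡ suc (2 * h)
odd-prime {p} p-prime 2<p with p % 2 | m%n<n p 2 | m≡m%n+[m/n]*n p 2
... | 0 | _ | p≡[p/2]*2 with prime⇒irreducible p-prime (divides (p / 2) p≡[p/2]*2)
...   | inj₂ 2≡p = ⊥-elim (<-irrefl 2≡p 2<p)
odd-prime {p} p-prime 2<p | 1 | _ | p≡1+[p/2]*2 = p / 2 , trans p≡1+[p/2]*2 (cong suc (*-comm (p / 2) 2))
odd-prime {p} p-prime 2<p | 2+ _ | s≤s (s≤s ()) | _

rank≤4⇒≤3 : ∀ {p z} → IsRankOfApparition p z → z ≤ 4 → p ≤ 3
rank≤4⇒≤3 {z = 1} (_ , p∣1 , _) _ = ≤-trans (∣⇒≤ p∣1) (s≤s z≤n)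
rank≤4⇒≤3 {z = 2} (_ , p∣1 , _) _ = ≤-trans (∣⇒≤ p∣1) (s≤s z≤n)
rank≤4⇒≤3 {z = 3} (_ , p∣2 , _) _ = ≤-trans (∣⇒≤ p∣2) (s≤s (s≤s z≤n))
rank≤4⇒≤3 {z = 4} (_ , p∣3 , _) _ = ∣⇒≤ p∣3
rank≤4⇒≤3 {z = 0} (() , _)
rank≤4⇒≤3 {z = suc (suc (suc (suc (suc _))))} _ (s≤s (s≤s (s≤s (s≤s ()))))

sophie-germain-rank∤q-1 : ∀ h {z} → 2 < suc (2 * h) → Prime (suc (2 * suc (2 * h))) →
                          IsRankOfApparition (suc (2 * suc (2 * h))) z → ¬ z ∣ 2 * h
sophie-germain-rank∤q-1 h {z} 2<q p-prime rank z∣2h = <⇒≱ (<-trans (s≤s (s≤s (s≤s (s≤s z≤n)))) 5<p) (rank≤4⇒≤3 rank (∣⇒≤ z∣4))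
  where
  q : ℕ
  q = suc (2 * h)
  5<p : 5 < suc (2 * q)
  5<p = s≤s (+-mono-≤ 2<q (≤-trans (<⇒≤ 2<q) (m≤m+n q 0)))
  module P = FibonacciModPrime q p-prime (>⇒∤ 5<p)
  z∣4h : z ∣ 2 * (2 * h)
  z∣4h = ∣n⇒∣m*n 2 z∣2h
  2q≡4h+2 : ∀ h → 2 * suc (2 * h) ≡ 2 * (2 * h) + 2
  2q≡4h+2 = solve-∀
  2q+2≡4h+4 : ∀ h → suc (suc (2 * suc (2 * h))) ≡ 2 * (2 * h) + 4
  2q+2≡4h+4 = solve-∀
  z∣4 : z ∣ 4
  z∣4 = [ (λ z∣2q → ∣-trans (∣m+n∣m⇒∣n (subst (z ∣_) (2q≡4h+2 h) z∣2q) z∣4h) (divides 2 refl))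
        , (λ z∣2q+2 → ∣m+n∣m⇒∣n (subst (z ∣_) (2q+2≡4h+4 h) z∣2q+2) z∣4h)
        ]′ (map (rank∣ p-prime rank) (rank∣ p-prime rank) P.r∣fib[r∓1])

lemma6p4 : (q : ℕ) → .{{_ : NonZero q}} → SophieGermain q → 5 < q →
           (z πq : ℕ) → IsRankOfApparition (2 * q + 1) z →
           IsPisanoPeriod q πq → z ∣ πq →
           (legendre 5 q ≡ -[1+ 0 ]) × (πq ∣ 2 * (q + 1))
lemma6p4 q (q-prime , p-prime) 5<q z πq rank pisano z∣πq
  with odd-prime q-prime (<-trans (s≤s (s≤s (s≤s z≤n))) 5<q)
... | h , refl = [ residue-impossible , non-residue ]′ Q.5^h≡±1
  where
  2<q : 2 < q
  2<q = <-trans (s≤s (s≤s (s≤s z≤n))) 5<q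
  module Q = FibonacciModPrime h q-prime (>⇒∤ 5<q)
  non-residue : 5 ^ h + 1 ≡ 0 mod q → (legendre 5 q ≡ -[1+ 0 ]) × (πq ∣ 2 * (q + 1))
  non-residue 5^h+1≡0 = Q.NonResidue.legendre[5/r]≡-1 5^h+1≡0 , pisano∣ pisano (Q.NonResidue.period 5^h+1≡0)
  residue-impossible : 5 ^ h ≡ 1 mod q → (legendre 5 q ≡ -[1+ 0 ]) × (πq ∣ 2 * (q + 1))
  residue-impossible 5^h≡1 = ⊥-elim (sophie-germain-rank∤q-1 h 2<q
    (subst Prime (+-comm (2 * q) 1) p-prime) (subst (λ p → IsRankOfApparition p z) (+-comm (2 * q) 1) rank)
    (∣-trans z∣πq (pisano∣ pisano (Q.residue-period 5^h≡1))))
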